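{- Let $\mathbf{e}$ be a square-free transitive relation on a set $E$. Then $\mathrm{int}(\mathbf{a})$ is closed for every closed $\mathbf{a}\subseteq\mathbf{e}$, and $\mathrm{cl}(\mathbf{a})$ is open for every open $\mathbf{a}\subseteq\mathbf{e}$.
   Context: A transitive relation $\mathbf{e}$ on $E$ is viewed as a set of ordered pairs. Write $x\lhd y$ if $(x,y)\in\mathbf{e}$ and $x\unlhd y$ if ($x\lhd y$ or $x=y$). For $a,b\in E$ let $[a,b]=\{x\in E: a\unlhd x\unlhd b\}$. $\mathbf{e}$ is square-free if for every $(a,b)\in\mathbf{e}$, any two elements $x,y\in[a,b]$ satisfy $x\unlhd y$ or $y\unlhd x$. A subset $\mathbf{a}\subseteq\mathbf{e}$ is closed if it is transitive and open if $\mathbf{e}\setminus\mathbf{a}$ is transitive. $\mathrm{cl}(\mathbf{a})$ is the transitive closure of $\mathbf{a}$ and $\mathrm{int}(\mathbf{a})$ is the largest open subset of $\mathbf{a}$. -}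

module Defs where

open import Level using (Level; _⊔_; suc)
open import Data.Product using (Σ; _×_; ∃)
open import Data.Sum using (_⊎_)
open import Relation.Nullary using (¬_)
open import Relation.Binary.Core using (Rel)
open import Relation.Binary.Definitions using (Transitive)
open import Relation.Binary.PropositionalEquality using (_≡_)
open import Relation.Binary.Construct.Closure.Transitive using (TransClosure)

private variable
  a ℓ ℓ₁ ℓ₂ : Level

_⊴[_]_ : {E : Set a} → E → Rel E ℓ → E → Set (a ⊔ ℓ)
x ⊴[ e ] y = e x y ⊎ x ≡ y

SquareFree : {E : Set a} → Rel E ℓ → Set (a ⊔ ℓ)
SquareFree {E = E} e =
  ∀ {p q} → e p q →
  ∀ {x y} → p ⊴[ e ] x → x ⊴[ e ] q → p ⊴[ e ] y → y ⊴[ e ] q →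
  x ⊴[ e ] y ⊎ y ⊴[ e ] x

_⊆ᵣ_ : {E : Set a} → Rel E ℓ₁ → Rel E ℓ₂ → Set (a ⊔ ℓ₁ ⊔ ℓ₂)
r ⊆ᵣ s = ∀ {x y} → r x y → s x y

_∖ᵣ_ : {E : Set a} → Rel E ℓ₁ → Rel E ℓ₂ → Rel E (ℓ₁ ⊔ ℓ₂)
(e ∖ᵣ r) x y = e x y × ¬ r x y

Closed : {E : Set a} → Rel E ℓ → Set (a ⊔ ℓ)
Closed r = Transitive r

Open : {E : Set a} → Rel E ℓ₁ → Rel E ℓ₂ → Set (a ⊔ ℓ₁ ⊔ ℓ₂)
Open e r = Transitive (e ∖ᵣ r)

cl : {E : Set a} → Rel E ℓ → Rel E (a ⊔ ℓ)
cl r = TransClosure r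

-- int_e(r): largest open subset of r, i.e. union of all open (w.r.t. e)
-- subsets of r (this union is itself open, hence the largest one)
int : {E : Set a} → Rel E ℓ₁ → Rel E ℓ₂ → Rel E (a ⊔ suc ℓ₁ ⊔ suc ℓ₂)
int {ℓ₁ = ℓ₁} {ℓ₂ = ℓ₂} e r x y =
  Σ (Rel _ (ℓ₁ ⊔ ℓ₂)) λ s → s ⊆ᵣ r × Open e s × s x y

module Submission where

-- Both halves rest on one "walking" argument.  Call a relation
-- r ⊆ e jump-free if no single r-step u → v can jump over a point y with
-- u ◁ y ◁ v when neither u → y nor y → v lies in cl(r).  For square-free e,
-- cl(r) is then open in e: if u ◁ v ◁ w with (u,v),(v,w) ∉ cl(r), walk along
-- any r-chain from u to w; square-freeness of [u,w] makes every chain point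
-- comparable with v, so some step starts at or below v and ends above v,
-- which jump-freeness forbids.
--
-- * If a is open, a itself is jump-free; so cl(a) is open.
-- * If a is closed, e∖a is jump-free, so C = cl(e∖a) is open.  Then
--   int(a) = a ∖ C: the right side is an open subset of a, and every open
--   subset of a avoids C.  Finally a ∖ C is closed, being the intersection
--   of the closed a with the complement of the open C.

open import Defs
open import Level using (Level; _⊔_; 0ℓ)
open import Data.Product using (_×_; _,_; proj₁; proj₂)
open import Data.Sum using (_⊎_; inj₁; inj₂)
open import Data.Empty using (⊥)
open import Relation.Nullary using (¬_)
open import Relation.Binary.Core using (Rel)
open import Relation.Binary.Definitions using (Transitive)
open import Relation.Binary.PropositionalEquality using (refl)
open import Relation.Binary.Construct.Closure.Transitive using ([_]; _∷_; _++_)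

private variable
  ℓ ℓ₁ ℓ₂ : Level

cl-least : {E : Set ℓ} {r : Rel E ℓ₁} {t : Rel E ℓ₂} →
           r ⊆ᵣ t → Transitive t → cl r ⊆ᵣ t
cl-least r⊆t tT [ rxy ]      = r⊆t rxy
cl-least r⊆t tT (rxy ∷ ryz) = tT (r⊆t rxy) (cl-least r⊆t tT ryz)

⊴-◁-trans : {E : Set ℓ} {e : Rel E ℓ₁} → Transitive e →
            ∀ {x y z} → x ⊴[ e ] y → e y z → e x z
⊴-◁-trans eT (inj₁ exy) eyz = eT exy eyz
⊴-◁-trans eT (inj₂ refl) eyz = eyz

JumpFree : {E : Set ℓ} → Rel E ℓ₁ → Rel E ℓ₂ → Set (ℓ ⊔ ℓ₁ ⊔ ℓ₂)
JumpFree e r = ∀ {u y v} → e u y → e y v → ¬ cl r u y → ¬ cl r y v → ¬ r u v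

module _ {E : Set ℓ} {e : Rel E ℓ₁} (eT : Transitive e) (sf : SquareFree e)
         {r : Rel E ℓ₂} (r⊆e : r ⊆ᵣ e) (jumpFree : JumpFree e r) where

  private
    C = cl r

    noCrossing : ∀ {p v q} → p ⊴[ e ] v → e v q → r p q →
                 ¬ C p v → ¬ C v q → ⊥
    noCrossing (inj₂ refl) evq rpq ¬Cpv ¬Cvq = ¬Cvq [ rpq ]
    noCrossing (inj₁ epv) evq rpq ¬Cpv ¬Cvq = jumpFree epv evq ¬Cpv ¬Cvq rpq

    -- Fix u ◁ v ◁ w with (v,w) ∉ cl(r) and walk along an r-chain from p to w,
    -- keeping the invariant u ⊴ p ⊴ v and (p,v) ∉ cl(r).
    module Walk {u v w} (euv : e u v) (evw : e v w) (¬Cvw : ¬ C v w) where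
      euw : e u w
      euw = eT euv evw

      compare : ∀ {q} → e u q → C q w → q ⊴[ e ] v ⊎ v ⊴[ e ] q
      compare euq Cqw = sf euw (inj₁ euq) (inj₁ (cl-least r⊆e eT Cqw)) (inj₁ euv) (inj₁ evw)

      walk : ∀ {p} → u ⊴[ e ] p → p ⊴[ e ] v → ¬ C p v → ¬ C p w
      walk u⊴p p⊴v ¬Cpv [ rpw ] = noCrossing p⊴v evw rpw ¬Cpv ¬Cvw
      walk u⊴p p⊴v ¬Cpv (rpq ∷ Cqw)
        with euq ← ⊴-◁-trans eT u⊴p (r⊆e rpq) | compare euq Cqw
      ... | inj₁ q⊴v = walk (inj₁ euq) q⊴v (λ Cqv → ¬Cpv (rpq ∷ Cqv)) Cqw
      ... | inj₂ (inj₂ refl) = ¬Cpv [ rpq ]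
      ... | inj₂ (inj₁ evq) = noCrossing p⊴v evq rpq ¬Cpv (λ Cvq → ¬Cvw (Cvq ++ Cqw))

  -- Starting the walk at p = u shows (u,w) ∉ cl(r).
  cl-open : Open e (cl r)
  cl-open (euv , ¬Cuv) (evw , ¬Cvw) =
    eT euv evw , Walk.walk euv evw ¬Cvw (inj₂ refl) (inj₁ euv) ¬Cuv

open⇒jumpFree : {E : Set ℓ} {e : Rel E ℓ₁} {a : Rel E ℓ₂} →
                Open e a → JumpFree e a
open⇒jumpFree ao euy eyv ¬Cuy ¬Cyv = proj₂ (ao (euy , λ auy → ¬Cuy [ auy ])
                                               (eyv , λ ayv → ¬Cyv [ ayv ]))

closed⇒complement-jumpFree : {E : Set ℓ} {e : Rel E ℓ₁} {a : Rel E ℓ₂} →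
                             Closed a → JumpFree e (e ∖ᵣ a)
closed⇒complement-jumpFree aT euy eyv ¬Cuy ¬Cyv (_ , ¬auv) =
  ¬Cuy [ euy , (λ auy → ¬Cyv [ eyv , (λ ayv → ¬auv (aT auy ayv)) ]) ]

-- The interior of a is described explicitly as a ∖ cl(e ∖ a).
module Interior {E : Set ℓ} (e a : Rel E ℓ) (eT : Transitive e) where

  core : Rel E ℓ
  core x y = a x y × ¬ cl (e ∖ᵣ a) x y

  -- a ∖ cl(e∖a) is open: a pair of e outside it is ¬¬-in cl(e∖a).
  core-open : Open e core
  core-open (euv , ¬core-uv) (evw , ¬core-vw) =
    eT euv evw , λ (_ , ¬Cuw) →
      inCl euv ¬core-uv λ Cuv → inCl evw ¬core-vw λ Cvw → ¬Cuw (Cuv ++ Cvw)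
    where
    inCl : ∀ {x y} → e x y → ¬ core x y → ¬ ¬ cl (e ∖ᵣ a) x y
    inCl exy ¬core ¬Cxy = ¬Cxy [ exy , (λ axy → ¬core (axy , ¬Cxy)) ]

  open-avoids : {s : Rel E ℓ} → s ⊆ᵣ a → Open e s → ∀ {x y} → s x y → ¬ cl (e ∖ᵣ a) x y
  open-avoids s⊆a so sxy Cxy =
    proj₂ (cl-least (λ (exy , ¬axy) → exy , λ sxy → ¬axy (s⊆a sxy)) so Cxy) sxy

  int⊆core : int e a ⊆ᵣ core
  int⊆core (s , s⊆a , so , sxy) = s⊆a sxy , open-avoids s⊆a so sxy

  core⊆int : core ⊆ᵣ int e a
  core⊆int cxy = core , proj₁ , core-open , cxy

  core-closed : a ⊆ᵣ e → Closed a → Open e (cl (e ∖ᵣ a)) → Closed core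
  core-closed a⊆e aT Copen (axy , ¬Cxy) (ayz , ¬Cyz) =
    aT axy ayz , proj₂ (Copen (a⊆e axy , ¬Cxy) (a⊆e ayz , ¬Cyz))

lemma4p2 : (E : Set) (e : Rel E 0ℓ) → Transitive e → SquareFree e →
    ((a : Rel E 0ℓ) → a ⊆ᵣ e → Closed a → Closed (int e a))
    × ((a : Rel E 0ℓ) → a ⊆ᵣ e → Open e a → Open e (cl a))
lemma4p2 E e eT sf = int-closed , cl-open-of-open
  where
  int-closed : (a : Rel E 0ℓ) → a ⊆ᵣ e → Closed a → Closed (int e a)
  int-closed a a⊆e aT ixy iyz =
    core⊆int (core-closed a⊆e aT C-open (int⊆core ixy) (int⊆core iyz))
    where
    open Interior e a eT
    C-open : Open e (cl (e ∖ᵣ a))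
    C-open = cl-open eT sf proj₁ (closed⇒complement-jumpFree aT)

  cl-open-of-open : (a : Rel E 0ℓ) → a ⊆ᵣ e → Open e a → Open e (cl a)
  cl-open-of-open a a⊆e ao = cl-open eT sf a⊆e (open⇒jumpFree ao)
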